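{- For all integers $n\ge 3$, $c_H(K_n-e)=\lfloor n/2\rfloor$, where $K_n-e$ is the complete graph $K_n$ with one edge removed.
   Context: Hyperopic Cops and Robbers on a finite connected simple graph $G$: one player controls $k$ cops, the other a single robber. The cops first choose starting vertices (several cops may share a vertex), then the robber chooses a starting vertex; afterwards, in each round, each cop moves to an adjacent vertex or stays put, and then the robber moves to an adjacent vertex or stays put. The robber always knows the cops' positions. The robber is invisible to the cops exactly when the robber's vertex is adjacent to the vertex of every cop (a robber on the same vertex as a cop is visible); otherwise the cops see the robber's position. The cops win if after finitely many rounds some cop occupies the robber's vertex, and the cops' strategy must guarantee this with certainty (no chance allowed). The hyperopic cop number $c_H(G)$ is the minimum $k$ for which $k$ cops have a winning strategy. -}

module Defs where

open import Data.Nat using (ℕ; zero; suc; _<_)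
open import Data.Nat.Base using (_≡ᵇ_)
open import Data.Fin using (Fin; toℕ)
open import Data.Bool using (Bool; true; false; _∧_; _∨_; not; if_then_else_)
open import Data.Maybe using (Maybe; just; nothing)
open import Data.List using (List; []; _∷_)
open import Data.Product using (Σ; ∃; _×_; _,_; proj₁; proj₂)
open import Data.Sum using (_⊎_)
open import Relation.Binary.PropositionalEquality using (_≡_)
open import Relation.Nullary using (¬_)

Adjacency : ℕ → Set
Adjacency n = Fin n → Fin n → Bool

KnMinusE : (n : ℕ) → Adjacency n
KnMinusE n i j =
  not (toℕ i ≡ᵇ toℕ j) ∧
  not (((toℕ i ≡ᵇ 0) ∧ (toℕ j ≡ᵇ 1)) ∨ ((toℕ i ≡ᵇ 1) ∧ (toℕ j ≡ᵇ 0)))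

Step : ∀ {n} → Adjacency n → Fin n → Fin n → Set
Step adj u v = (u ≡ v) ⊎ (adj u v ≡ true)

allFin : ∀ {k} → (Fin k → Bool) → Bool
allFin {zero} f = true
allFin {suc k} f = f Fin.zero ∧ allFin (λ i → f (Fin.suc i))

Cops : ℕ → ℕ → Set
Cops n k = Fin k → Fin n

Obs : ℕ → Set
Obs n = Maybe (Fin n)

observe : ∀ {n k} → Adjacency n → Cops n k → Fin n → Obs n
observe adj c r = if allFin (λ i → adj (c i) r) then nothing else just r

-- A deterministic cop strategy: starting positions, and a move rule depending
-- on the full observation history (most recent first) and the current cop
-- positions; every output is a legal move.
record CopStrategy {n : ℕ} (adj : Adjacency n) (k : ℕ) : Set where
  field
    start : Cops n k
    move  : List (Obs n) → Cops n k → Cops n k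
    legal : ∀ h c i → Step adj (c i) (move h c i)

open CopStrategy public

-- a robber walk: r t is the robber's vertex after round t (r 0 = start)
IsWalk : ∀ {n} → Adjacency n → (ℕ → Fin n) → Set
IsWalk adj r = ∀ t → Step adj (r t) (r (suc t))

-- play t = (cop positions after round t, observation history so far).
-- Observations are made after the robber's placement, and after every cop
-- move and every robber move.
play : ∀ {n k} {adj : Adjacency n} → CopStrategy adj k → (ℕ → Fin n) → ℕ →
       Cops n k × List (Obs n)
play {adj = adj} σ r zero = start σ , (observe adj (start σ) (r 0) ∷ [])
play {adj = adj} σ r (suc t) =
  let c = proj₁ (play σ r t)
      h = proj₂ (play σ r t)
      c' = move σ h c
  in c' , (observe adj c' (r (suc t)) ∷ observe adj c' (r t) ∷ h)

copsAt : ∀ {n k} {adj : Adjacency n} → CopStrategy adj k → (ℕ → Fin n) → ℕ → Cops n k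
copsAt σ r t = proj₁ (play σ r t)

Caught : ∀ {n k} → Cops n k → Fin n → Set
Caught c v = ∃ λ i → c i ≡ v

-- capture happens at some finite time: either a cop is on the robber's vertex
-- after round t, or a cop moves onto the robber in round t+1 (before the
-- robber's move).
Captures : ∀ {n k} {adj : Adjacency n} → CopStrategy adj k → (ℕ → Fin n) → Set
Captures σ r = ∃ λ t → Caught (copsAt σ r t) (r t) ⊎ Caught (copsAt σ r (suc t)) (r t)

CopsWin : ∀ {n} → Adjacency n → ℕ → Set
CopsWin adj k = Σ (CopStrategy adj k) λ σ → ∀ r → IsWalk adj r → Captures σ r

HyperopicCopNumber : ∀ {n} → Adjacency n → ℕ → Set
HyperopicCopNumber adj m = CopsWin adj m × (∀ k → k < m → ¬ CopsWin adj k)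

-- Let N = m + 2 be the number of vertices, 0 and 1 the two non-adjacent ones, and call the other
-- m vertices big; a big vertex is adjacent to every vertex other than itself.
--
-- Upper bound: with k cops, k ≤ m < 2k, place cop i on big vertex k + i, or on the vertex 1 when
-- that does not exist; then move every cop to big vertex i; then to big vertex k + i, or else 0.
-- Every vertex except 0 is occupied in one of the first two placements, and a robber starting
-- on 0 cannot reach 1, while every vertex except 1 is occupied in the last two placements.
--
-- Lower bound: if 2k ≤ m, the cops' positions in two consecutive rounds occupy at most m
-- vertices. Either some big vertex is free, or by pigeonhole all of them are on big vertices;
-- in both cases the robber can step onto a vertex adjacent to all of them. Such a robber is never
-- seen, so the cops play as if every observation were empty, and the robber, who can predict
-- that play, stays invisible to the cops before and after each of their moves.
module Submission where

open import Defs
open import Data.Nat using (ℕ; _≤_; _/_)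
open import Data.Nat.Base using (zero; suc; _+_; _*_; _<_; _∸_; _≡ᵇ_; z≤n; s≤s; s≤s⁻¹)
open import Data.Nat.Properties
  using (_≟_; _<?_; <⇒≱; ≮⇒≥; ≤-trans; <-trans; ≤-<-trans; +-mono-≤; +-monoˡ-≤; +-monoʳ-<;
         +-cancelˡ-<; +-suc; m+[n∸m]≡n; n<1+n; *-comm; +-identityʳ; module ≤-Reasoning)
open import Data.Nat.DivMod using (_%_; m≡m%n+[m/n]*n; m%n<n; m/n*n≤m; m/n<m; m/n≡1+[m∸n]/n)
open import Data.Fin.Base using (Fin; zero; suc; toℕ; fromℕ; fromℕ<; inject≤; punchOut; _↑ˡ_; _↑ʳ_)
import Data.Fin.Properties as Finₚ
open import Data.Vec.Functional using (_++_)
open import Data.Vec.Functional.Properties using (lookup-++ˡ; lookup-++ʳ)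
open import Data.Bool.Base using (Bool; true; false; _∧_; _∨_; not; if_then_else_)
open import Data.Maybe.Base using (nothing)
open import Data.List.Base using (List; []; _∷_)
open import Data.Product.Base using (∃; _×_; _,_; proj₁; proj₂)
open import Data.Sum.Base using (_⊎_; inj₁; inj₂; [_,_]′)
import Data.Sum.Base as Sum
open import Data.Empty using (⊥-elim)
open import Function.Base using (_∘_)
open import Function.Definitions using (Injective)
open import Relation.Nullary using (¬_; Dec; yes; no)
open import Relation.Nullary.Decidable using (dec-true; dec-false)
open import Relation.Binary.PropositionalEquality

≡ᵇ-true : ∀ {a b} → a ≡ b → (a ≡ᵇ b) ≡ true
≡ᵇ-true {a} {b} = dec-true (a ≟ b)

≡ᵇ-false : ∀ {a b} → a ≢ b → (a ≡ᵇ b) ≡ false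
≡ᵇ-false {a} {b} = dec-false (a ≟ b)

big : ∀ {m} → Fin m → Fin (2 + m)
big w = suc (suc w)

2≤big : ∀ {m} (w : Fin m) → 2 ≤ toℕ (big w)
2≤big w = s≤s (s≤s z≤n)

KnMinusE-irrefl : ∀ {n} (v : Fin n) → KnMinusE n v v ≡ false
KnMinusE-irrefl v rewrite ≡ᵇ-true {toℕ v} refl = refl

KnMinusE-adjacent : ∀ {n} {u v : Fin n} → u ≢ v → 2 ≤ toℕ u ⊎ 2 ≤ toℕ v → KnMinusE n u v ≡ true
KnMinusE-adjacent {u = u} {v} u≢v big =
  cong₂ (λ x y → not x ∧ y) (≡ᵇ-false (u≢v ∘ Finₚ.toℕ-injective))
                            (notMissingEdge (toℕ u) (toℕ v) big)
  where
  notMissingEdge : ∀ a b → 2 ≤ a ⊎ 2 ≤ b →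
                   not (((a ≡ᵇ 0) ∧ (b ≡ᵇ 1)) ∨ ((a ≡ᵇ 1) ∧ (b ≡ᵇ 0))) ≡ true
  notMissingEdge (suc (suc a)) b             _ = refl
  notMissingEdge zero          (suc (suc b)) _ = refl
  notMissingEdge (suc zero)    (suc (suc b)) _ = refl
  notMissingEdge zero          zero          (inj₁ ())
  notMissingEdge zero          zero          (inj₂ ())
  notMissingEdge zero          (suc zero)    (inj₁ ())
  notMissingEdge zero          (suc zero)    (inj₂ (s≤s ()))
  notMissingEdge (suc zero)    zero          (inj₁ (s≤s ()))
  notMissingEdge (suc zero)    zero          (inj₂ ())
  notMissingEdge (suc zero)    (suc zero)    (inj₁ (s≤s ()))
  notMissingEdge (suc zero)    (suc zero)    (inj₂ (s≤s ()))

KnMinusE-step : ∀ {n} {u v : Fin n} → 2 ≤ toℕ u ⊎ 2 ≤ toℕ v → Step (KnMinusE n) u v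
KnMinusE-step {u = u} {v} big with u Finₚ.≟ v
... | yes u≡v = inj₁ u≡v
... | no u≢v = inj₂ (KnMinusE-adjacent u≢v big)

moveToward : ∀ {n} → Adjacency n → Fin n → Fin n → Fin n
moveToward adj u v = if adj u v then v else u

moveToward-legal : ∀ {n} (adj : Adjacency n) u v → Step adj u (moveToward adj u v)
moveToward-legal adj u v with adj u v in uv
... | true = inj₂ uv
... | false = inj₁ refl

moveToward-reaches : ∀ {n} {adj : Adjacency n} {u v} → Step adj u v → moveToward adj u v ≡ v
moveToward-reaches {adj = adj} {u} (inj₁ refl) with adj u u
... | true = refl
... | false = refl
moveToward-reaches (inj₂ uv) rewrite uv = refl

rounds : ∀ {A : Set} → List A → ℕ
rounds (_ ∷ _ ∷ h) = suc (rounds h)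
rounds _ = zero

rounds-history : ∀ {n k} {adj : Adjacency n} (σ : CopStrategy adj k) r t →
                 rounds (proj₂ (play σ r t)) ≡ t
rounds-history σ r zero = refl
rounds-history σ r (suc t) = cong suc (rounds-history σ r t)

module FollowSchedule {n k} {adj : Adjacency n} (P : ℕ → Cops n k)
                      (P-legal : ∀ t i → Step adj (P t i) (P (suc t) i)) where

  follow : CopStrategy adj k
  follow = record
    { start = P 0
    ; move  = λ h c i → moveToward adj (c i) (P (suc (rounds h)) i)
    ; legal = λ h c i → moveToward-legal adj (c i) (P (suc (rounds h)) i)
    }

  copsAt-follow : ∀ r t i → copsAt follow r t i ≡ P t i
  copsAt-follow r zero i = refl
  copsAt-follow r (suc t) i rewrite rounds-history follow r t | copsAt-follow r t i =
    moveToward-reaches {adj = adj} (P-legal t i)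

  caught-follow : ∀ r t {v} → Caught (P t) v → Caught (copsAt follow r t) v
  caught-follow r t (i , Pti≡v) = i , trans (copsAt-follow r t i) Pti≡v

  follow-captures : (∀ v → Caught (P 0) v ⊎ Caught (P 1) v ⊎
                           (∀ w → Step adj v w → Caught (P 1) w ⊎ Caught (P 2) w)) →
                    ∀ r → IsWalk adj r → Captures follow r
  follow-captures guarded r walk with guarded (r 0)
  ... | inj₁ c = 0 , inj₁ (caught-follow r 0 c)
  ... | inj₂ (inj₁ c) = 0 , inj₂ (caught-follow r 1 c)
  ... | inj₂ (inj₂ next) = 1 , Sum.map (caught-follow r 1) (caught-follow r 2) (next (r 1) (walk 0))

lastIndex-reaches : ∀ {m k} → m < k + k → ∃ λ (i : Fin k) → m ≤ k + toℕ i
lastIndex-reaches {m} {suc h} (s≤s m≤h+1+h) =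
  fromℕ h , subst (λ x → m ≤ suc (h + x)) (sym (Finₚ.toℕ-fromℕ h))
                  (subst (m ≤_) (+-suc h h) m≤h+1+h)

module TwoRoundSweep {m k} (k≤m : k ≤ m) (m<k+k : m < k + k) where

  low : Cops (2 + m) k
  low i = big (inject≤ i k≤m)

  highOr : Fin (2 + m) → Cops (2 + m) k
  highOr d i with k + toℕ i <? m
  ... | yes k+i<m = big (fromℕ< k+i<m)
  ... | no _ = d

  highOr-high : ∀ {d i} {w : Fin m} → k + toℕ i ≡ toℕ w → highOr d i ≡ big w
  highOr-high {i = i} {w} k+i≡w with k + toℕ i <? m
  ... | yes k+i<m = cong big (Finₚ.toℕ-injective (trans (Finₚ.toℕ-fromℕ< k+i<m) k+i≡w))
  ... | no k+i≮m = ⊥-elim (k+i≮m (subst (_< m) (sym k+i≡w) (Finₚ.toℕ<n w)))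

  highOr-default : ∀ {d i} → m ≤ k + toℕ i → highOr d i ≡ d
  highOr-default {i = i} m≤k+i with k + toℕ i <? m
  ... | yes k+i<m = ⊥-elim (<⇒≱ k+i<m m≤k+i)
  ... | no _ = refl

  highOr-caught : ∀ d → Caught (highOr d) d
  highOr-caught d = let i , m≤k+i = lastIndex-reaches m<k+k in i , highOr-default m≤k+i

  big-caught : ∀ d (w : Fin m) → Caught low (big w) ⊎ Caught (highOr d) (big w)
  big-caught d w with toℕ w <? k
  ... | yes w<k = inj₁ (fromℕ< w<k , cong big (Finₚ.toℕ-injective
                          (trans (Finₚ.toℕ-inject≤ _ k≤m) (Finₚ.toℕ-fromℕ< w<k))))
  ... | no w≮k = inj₂ (fromℕ< i<k , highOr-high (trans (cong (k +_) (Finₚ.toℕ-fromℕ< i<k)) k+i≡w))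
    where
    k+i≡w : k + (toℕ w ∸ k) ≡ toℕ w
    k+i≡w = m+[n∸m]≡n (≮⇒≥ w≮k)
    i<k : toℕ w ∸ k < k
    i<k = +-cancelˡ-< k _ k (subst (_< k + k) (sym k+i≡w) (<-trans (Finₚ.toℕ<n w) m<k+k))

  schedule : ℕ → Cops (2 + m) k
  schedule zero = highOr (suc zero)
  schedule (suc zero) = low
  schedule (suc (suc _)) = highOr zero

  schedule-legal : ∀ t i → Step (KnMinusE (2 + m)) (schedule t i) (schedule (suc t) i)
  schedule-legal zero i = KnMinusE-step (inj₂ (2≤big _))
  schedule-legal (suc zero) i = KnMinusE-step (inj₁ (2≤big _))
  schedule-legal (suc (suc t)) i = inj₁ refl

  open FollowSchedule {adj = KnMinusE (2 + m)} schedule schedule-legal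

  guarded : ∀ v → Caught (schedule 0) v ⊎ Caught (schedule 1) v ⊎
                  (∀ w → Step (KnMinusE (2 + m)) v w → Caught (schedule 1) w ⊎ Caught (schedule 2) w)
  guarded zero = inj₂ (inj₂ λ where
    zero _ → inj₂ (highOr-caught zero)
    (suc zero) (inj₁ ())
    (suc zero) (inj₂ ())
    (suc (suc w)) _ → big-caught zero w)
  guarded (suc zero) = inj₁ (highOr-caught (suc zero))
  guarded (suc (suc w)) = [ inj₂ ∘ inj₁ , inj₁ ]′ (big-caught (suc zero) w)

  copsWin : CopsWin (KnMinusE (2 + m)) k
  copsWin = follow , follow-captures guarded

Invisible : ∀ {n k} → Adjacency n → Cops n k → Fin n → Set
Invisible adj c v = ∀ i → adj (c i) v ≡ true

allFin-true : ∀ {k} (f : Fin k → Bool) → (∀ i → f i ≡ true) → allFin f ≡ true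
allFin-true {zero} f _ = refl
allFin-true {suc k} f all rewrite all zero = allFin-true (f ∘ suc) (all ∘ suc)

module _ {n} (adj : Adjacency n) where

  observe-invisible : ∀ {k} {c : Cops n k} {v} → Invisible adj c v → observe adj c v ≡ nothing
  observe-invisible inv rewrite allFin-true _ inv = refl

  invisible⇒¬caught : ∀ {k} {c : Cops n k} {v} →
                      (∀ u → adj u u ≡ false) → Invisible adj c v → ¬ Caught c v
  invisible⇒¬caught irrefl inv (i , refl) with () ← trans (sym (inv i)) (irrefl _)

  Invisible-++⁻ : ∀ {k l} {c : Cops n k} {d : Cops n l} {v} →
                  Invisible adj (c ++ d) v → Invisible adj c v × Invisible adj d v
  Invisible-++⁻ {k} {l} {c} {d} {v} inv =
    (λ i → subst (λ u → adj u v ≡ true) (lookup-++ˡ c d i) (inv (i ↑ˡ l))) ,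
    (λ i → subst (λ u → adj u v ≡ true) (lookup-++ʳ c d i) (inv (k ↑ʳ i)))

module Unseen {n k} {adj : Adjacency n} (σ : CopStrategy adj k) where

  unseenPlay : ℕ → Cops n k × List (Obs n)
  unseenPlay zero = start σ , nothing ∷ []
  unseenPlay (suc t) = move σ (proj₂ (unseenPlay t)) (proj₁ (unseenPlay t))
                     , nothing ∷ nothing ∷ proj₂ (unseenPlay t)

  unseenCops : ℕ → Cops n k
  unseenCops t = proj₁ (unseenPlay t)

  Hidden : (ℕ → Fin n) → Set
  Hidden r = ∀ t → Invisible adj (unseenCops t) (r t) × Invisible adj (unseenCops (suc t)) (r t)

  play-hidden : ∀ {r} → Hidden r → ∀ t → play σ r t ≡ unseenPlay t
  play-hidden hidden zero = cong (λ o → start σ , o ∷ []) (observe-invisible adj (proj₁ (hidden 0)))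
  play-hidden hidden (suc t) rewrite play-hidden hidden t =
    cong₂ (λ o o′ → unseenCops (suc t) , o ∷ o′ ∷ proj₂ (unseenPlay t))
          (observe-invisible adj (proj₁ (hidden (suc t)))) (observe-invisible adj (proj₂ (hidden t)))

  hidden⇒¬captures : (∀ u → adj u u ≡ false) → ∀ {r} → Hidden r → ¬ Captures σ r
  hidden⇒¬captures irrefl hidden (t , caught)
    rewrite play-hidden hidden t =
    [ invisible⇒¬caught adj irrefl (proj₁ (hidden t))
    , invisible⇒¬caught adj irrefl (proj₂ (hidden t)) ]′ caught

Escapes : ∀ {n} → Adjacency n → ℕ → Set
Escapes {n} adj l = ∀ (c : Cops n l) (p : Fin n) → ∃ λ v → Invisible adj c v × Step adj p v

escapes⇒¬CopsWin : ∀ {n k} {adj : Adjacency (suc n)} →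
                   (∀ u → adj u u ≡ false) → Escapes adj (k + k) → ¬ CopsWin adj k
escapes⇒¬CopsWin {n} {k} {adj} irrefl escape (σ , wins) = hidden⇒¬captures irrefl hidden (wins r walk)
  where
  open Unseen σ

  twoRounds : ℕ → Cops (suc n) (k + k)
  twoRounds t = unseenCops t ++ unseenCops (suc t)

  r : ℕ → Fin (suc n)
  positionBefore : ℕ → Fin (suc n)
  r t = proj₁ (escape (twoRounds t) (positionBefore t))
  positionBefore zero = zero -- any vertex: the start is not a move
  positionBefore (suc t) = r t

  hidden : Hidden r
  hidden t = Invisible-++⁻ adj {c = unseenCops t} (proj₁ (proj₂ (escape (twoRounds t) (positionBefore t))))

  walk : IsWalk adj r
  walk t = proj₂ (proj₂ (escape (twoRounds (suc t)) (r t)))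

image⊇⇒image⊆ : ∀ {a} {A : Set a} {m n} {f : Fin m → A} {e : Fin n → A} →
                m ≤ n → Injective _≡_ _≡_ e → (∀ w → ∃ λ j → f j ≡ e w) →
                ∀ j → ¬ (∀ w → f j ≢ e w)
image⊇⇒image⊆ {m = suc m} {n} {f} {e} m≤n e-injective covers j f[j]∉e =
  <⇒≱ m≤n (Finₚ.injective⇒≤ g-injective)
  where
  j≢cover : ∀ w → j ≢ proj₁ (covers w)
  j≢cover w j≡ = f[j]∉e w (trans (cong f j≡) (proj₂ (covers w)))

  g : Fin n → Fin m
  g w = punchOut (j≢cover w)

  g-injective : Injective _≡_ _≡_ g
  g-injective {a} {b} ga≡gb = e-injective (begin
    e a                  ≡⟨ sym (proj₂ (covers a)) ⟩
    f (proj₁ (covers a)) ≡⟨ cong f (Finₚ.punchOut-injective (j≢cover a) (j≢cover b) ga≡gb) ⟩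
    f (proj₁ (covers b)) ≡⟨ proj₂ (covers b) ⟩
    e b                  ∎)
    where open ≡-Reasoning

caught? : ∀ {n k} (c : Cops n k) (v : Fin n) → Dec (Caught c v)
caught? c v = Finₚ.any? (λ j → c j Finₚ.≟ v)

KnMinusE-escapes : ∀ {l m} → l ≤ m → Escapes (KnMinusE (2 + m)) l
KnMinusE-escapes {m = m} l≤m c p with Finₚ.all? (caught? c ∘ big)
... | no ¬allOccupied =
  let w , unoccupied = Finₚ.¬∀⟶∃¬ m _ (caught? c ∘ big) ¬allOccupied
  in big w , (λ j → KnMinusE-adjacent (λ cj≡w → unoccupied (j , cj≡w)) (inj₂ (2≤big w)))
           , KnMinusE-step (inj₂ (2≤big w))
... | yes allOccupied = hideOnLow p
  where
  allOnBig : ∀ j → 2 ≤ toℕ (c j)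
  allOnBig j with c j | image⊇⇒image⊆ l≤m (Finₚ.suc-injective ∘ Finₚ.suc-injective) allOccupied j
  ... | zero        | notOffBig = ⊥-elim (notOffBig λ w ())
  ... | suc zero    | notOffBig = ⊥-elim (notOffBig λ w ())
  ... | suc (suc w) | _         = 2≤big w

  invisibleLow : (u : Fin (2 + m)) → toℕ u < 2 → Invisible (KnMinusE (2 + m)) c u
  invisibleLow u u<2 j =
    KnMinusE-adjacent {u = c j} (λ cj≡u → <⇒≱ u<2 (subst (λ x → 2 ≤ toℕ x) cj≡u (allOnBig j)))
                      (inj₁ (allOnBig j))

  hideOnLow : (p : Fin (2 + m)) → ∃ λ v → Invisible (KnMinusE (2 + m)) c v × Step (KnMinusE (2 + m)) p v
  hideOnLow zero = zero , invisibleLow zero (s≤s z≤n) , inj₁ refl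
  hideOnLow (suc zero) = suc zero , invisibleLow (suc zero) (s≤s (s≤s z≤n)) , inj₁ refl
  hideOnLow (suc (suc w)) = zero , invisibleLow zero (s≤s z≤n) , inj₂ refl

KnMinusE-¬CopsWin : ∀ {m k} → k + k ≤ m → ¬ CopsWin (KnMinusE (2 + m)) k
KnMinusE-¬CopsWin k+k≤m = escapes⇒¬CopsWin KnMinusE-irrefl (KnMinusE-escapes k+k≤m)

m*2≡m+m : ∀ m → m * 2 ≡ m + m
m*2≡m+m m = trans (*-comm m 2) (cong (m +_) (+-identityʳ m))

n/2+n/2≤n : ∀ n → n / 2 + n / 2 ≤ n
n/2+n/2≤n n = subst (_≤ n) (m*2≡m+m (n / 2)) (m/n*n≤m n 2)

n≤1+n/2+n/2 : ∀ n → n ≤ suc (n / 2 + n / 2)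
n≤1+n/2+n/2 n = begin
  n                   ≡⟨ m≡m%n+[m/n]*n n 2 ⟩
  n % 2 + n / 2 * 2   ≤⟨ +-monoˡ-≤ (n / 2 * 2) (s≤s⁻¹ (m%n<n n 2)) ⟩
  suc (n / 2 * 2)     ≡⟨ cong suc (m*2≡m+m (n / 2)) ⟩
  suc (n / 2 + n / 2) ∎
  where open ≤-Reasoning

mainTheorem4 : (n : ℕ) → 3 ≤ n → HyperopicCopNumber (KnMinusE n) (n / 2)
mainTheorem4 (suc (suc (suc m))) (s≤s (s≤s (s≤s _))) =
  subst (HyperopicCopNumber (KnMinusE (2 + M))) (sym n/2≡1+h) (copsWin , fewerLose)
  where
  M = suc m
  h = M / 2

  n/2≡1+h : (2 + M) / 2 ≡ suc h
  n/2≡1+h = m/n≡1+[m∸n]/n {2 + M} {2} (s≤s (s≤s z≤n))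

  copsWin : CopsWin (KnMinusE (2 + M)) (suc h)
  copsWin = TwoRoundSweep.copsWin (m/n<m M 2 (s≤s (s≤s z≤n)))
                                  (≤-<-trans (n≤1+n/2+n/2 M) (s≤s (+-monoʳ-< h (n<1+n h))))

  fewerLose : ∀ k → k < suc h → ¬ CopsWin (KnMinusE (2 + M)) k
  fewerLose k (s≤s k≤h) = KnMinusE-¬CopsWin (≤-trans (+-mono-≤ k≤h k≤h) (n/2+n/2≤n M))
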